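{- A partial latin square $P$ satisfies Hall's Condition if and only if the Hall Inequality $\sum_{\sigma=1}^n\alpha(\sigma,T)\ge |T|$ holds for every set $T$ of empty cells of $P$.
   Context: A partial latin square of order $n$ is an $n\times n$ array in which some cells are filled with symbols from $\{1,\dots,n\}$, no symbol appearing twice in any row or column. A symbol is missing from a row (column) if it does not appear in a filled cell of that row (column). A cell supports a symbol $\sigma$ if it contains $\sigma$, or it is empty and $\sigma$ is missing from both its row and its column. A set of cells is independent if no two lie in the same row or column; an independent set for $\sigma$ is an independent set all of whose cells support $\sigma$. For a set $T$ of cells, $\alpha(\sigma,T)$ is the maximum size of a subset of $T$ that is an independent set for $\sigma$. $P$ satisfies Hall's Condition if $\sum_{\sigma=1}^n\alpha(\sigma,T)\ge|T|$ for every set $T$ of cells of $P$. -}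

module Defs where

open import Data.Nat using (ℕ; _≤_; _+_)
open import Data.Fin using (Fin)
open import Data.Bool using (Bool; true; false; if_then_else_)
open import Data.Maybe using (Maybe; just; nothing)
open import Data.List using (List; map; allFin)
open import Data.Nat.ListAction using (sum)
open import Data.Product using (_×_; Σ)
open import Data.Sum using (_⊎_)
open import Relation.Binary.PropositionalEquality using (_≡_; _≢_)

-- Symbols {1,…,n} are represented by Fin n (symbol k+1 ↦ k).
-- A (possibly) partial array of order n: each cell is empty (nothing) or holds a symbol.
Array : ℕ → Set
Array n = Fin n → Fin n → Maybe (Fin n)

IsPartialLatinSquare : {n : ℕ} → Array n → Set
IsPartialLatinSquare {n} P =
  (∀ (r c c' : Fin n) (s : Fin n) → P r c ≡ just s → P r c' ≡ just s → c ≡ c')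
  × (∀ (r r' c : Fin n) (s : Fin n) → P r c ≡ just s → P r' c ≡ just s → r ≡ r')

CellSet : ℕ → Set
CellSet n = Fin n → Fin n → Bool

∣_∣ᶜ : {n : ℕ} → CellSet n → ℕ
∣_∣ᶜ {n} T = sum (map (λ r → sum (map (λ c → if T r c then 1 else 0) (allFin n))) (allFin n))

_⊆ᶜ_ : {n : ℕ} → CellSet n → CellSet n → Set
_⊆ᶜ_ {n} S T = ∀ (r c : Fin n) → S r c ≡ true → T r c ≡ true

MissingFromRow : {n : ℕ} → Array n → Fin n → Fin n → Set
MissingFromRow {n} P r σ = ∀ (c : Fin n) → P r c ≢ just σ

MissingFromCol : {n : ℕ} → Array n → Fin n → Fin n → Set
MissingFromCol {n} P c σ = ∀ (r : Fin n) → P r c ≢ just σ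

Supports : {n : ℕ} → Array n → Fin n → Fin n → Fin n → Set
Supports P r c σ =
  P r c ≡ just σ ⊎ (P r c ≡ nothing × MissingFromRow P r σ × MissingFromCol P c σ)

Independent : {n : ℕ} → CellSet n → Set
Independent {n} S =
  (∀ (r c c' : Fin n) → S r c ≡ true → S r c' ≡ true → c ≡ c')
  × (∀ (r r' c : Fin n) → S r c ≡ true → S r' c ≡ true → r ≡ r')

IndependentFor : {n : ℕ} → Array n → Fin n → CellSet n → Set
IndependentFor {n} P σ S = Independent S × (∀ (r c : Fin n) → S r c ≡ true → Supports P r c σ)

-- IsAlpha P σ T k  :  k = α(σ,T), the maximum size of a subset of T that is an
-- independent set for σ (attained, and an upper bound).
IsAlpha : {n : ℕ} → Array n → Fin n → CellSet n → ℕ → Set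
IsAlpha {n} P σ T k =
  Σ (CellSet n) (λ S → S ⊆ᶜ T × IndependentFor P σ S × ∣ S ∣ᶜ ≡ k)
  × (∀ (S : CellSet n) → S ⊆ᶜ T → IndependentFor P σ S → ∣ S ∣ᶜ ≤ k)

HallInequality : {n : ℕ} → Array n → CellSet n → Set
HallInequality {n} P T =
  ∀ (α : Fin n → ℕ) → (∀ (σ : Fin n) → IsAlpha P σ T (α σ)) →
    ∣ T ∣ᶜ ≤ sum (map α (allFin n))

HallsCondition : {n : ℕ} → Array n → Set
HallsCondition {n} P = ∀ (T : CellSet n) → HallInequality P T

EmptyCells : {n : ℕ} → Array n → CellSet n → Set
EmptyCells {n} P T = ∀ (r c : Fin n) → T r c ≡ true → P r c ≡ nothing

-- A filled cell of T containing σ is compatible with every independent set for σ made of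
-- empty cells: σ is missing from the rows and columns of those empty cells, and no two cells
-- containing σ share a line because P is latin.  Hence α(σ,T) ≥ α(σ,T') + (number of cells
-- of T containing σ), where T' is the set of empty cells of T.  Summing over σ, the filled
-- cells of T are counted exactly once, so the Hall Inequality for T' implies it for T.
module Submission where

open import Defs
open import Data.Bool using (Bool; true; false; if_then_else_; _∧_; _∨_; not)
open import Data.Bool.Properties using (∧-conicalˡ; ∧-conicalʳ; ∨-zeroʳ)
open import Data.Empty using (⊥; ⊥-elim)
open import Data.Fin using (Fin; zero; suc)
import Data.Fin.Properties as Fin
open import Data.List using (map; allFin; tabulate)
open import Data.Maybe using (just; nothing; is-nothing)
open import Data.Maybe.Properties using (≡-dec)
open import Data.Nat using (ℕ; zero; suc; _+_; _≤_; z≤n)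
open import Data.Nat.ListAction using (sum)
open import Data.Nat.Properties
  using (≤-refl; ≤-trans; ≤-reflexive; +-mono-≤; +-monoʳ-≤; +-cancelʳ-≤; +-0-commutativeMonoid; module ≤-Reasoning)
open import Data.Product using (Σ; _×_; _,_; proj₁; proj₂)
open import Data.Sum using (_⊎_; inj₁; inj₂)
open import Function using (_∘_; id)
open import Relation.Nullary.Decidable using (Dec; does; proof; dec-true)
open import Relation.Nullary.Reflects using (Reflects; invert)
open import Relation.Binary.PropositionalEquality
open import Algebra.Properties.CommutativeMonoid.Sum +-0-commutativeMonoid
  using (sum-syntax; ∑-distrib-+; ∑-comm; sum-cong-≗; sum-replicate-zero)

does-true⇒ : ∀ {A : Set} (a? : Dec A) → does a? ≡ true → A
does-true⇒ {A} a? e = invert (subst (Reflects A) e (proof a?))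

∨-true : ∀ {a b} → a ∨ b ≡ true → a ≡ true ⊎ b ≡ true
∨-true {true}  _ = inj₁ refl
∨-true {false} e = inj₂ e

χ : Bool → ℕ
χ b = if b then 1 else 0

sum-map-tabulate : ∀ {n} {A : Set} (f : A → ℕ) (g : Fin n → A) →
  sum (map f (tabulate g)) ≡ ∑[ i < n ] f (g i)
sum-map-tabulate {zero}  f g = refl
sum-map-tabulate {suc n} f g = cong (f (g zero) +_) (sum-map-tabulate f (g ∘ suc))

sum-allFin : ∀ {n} (f : Fin n → ℕ) → sum (map f (allFin n)) ≡ ∑[ i < n ] f i
sum-allFin f = sum-map-tabulate f id

∑-mono-≤ : ∀ {n} {f g : Fin n → ℕ} → (∀ i → f i ≤ g i) → ∑[ i < n ] f i ≤ ∑[ i < n ] g i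
∑-mono-≤ {zero}  f≤g = z≤n
∑-mono-≤ {suc n} f≤g = +-mono-≤ (f≤g zero) (∑-mono-≤ (f≤g ∘ suc))

∑-χ-≟ : ∀ {n} (j : Fin n) → ∑[ i < n ] χ (does (j Fin.≟ i)) ≡ 1
∑-χ-≟ {suc n} zero    = cong suc (sum-replicate-zero n)
∑-χ-≟ {suc n} (suc j) = ∑-χ-≟ j

infixr 25 _∩ᶜ_ _∖ᶜ_
infixr 24 _∪ᶜ_

_∩ᶜ_ _∪ᶜ_ _∖ᶜ_ : ∀ {n} → CellSet n → CellSet n → CellSet n
(A ∩ᶜ B) r c = A r c ∧ B r c
(A ∪ᶜ B) r c = A r c ∨ B r c
(A ∖ᶜ B) r c = A r c ∧ not (B r c)

Disjointᶜ : ∀ {n} → CellSet n → CellSet n → Set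
Disjointᶜ {n} A B = ∀ (r c : Fin n) → A r c ≡ true → B r c ≡ true → ⊥

∣∣ᶜ-as-∑ : ∀ {n} (T : CellSet n) → ∣ T ∣ᶜ ≡ ∑[ r < n ] ∑[ c < n ] χ (T r c)
∣∣ᶜ-as-∑ {n} T =
  trans (sum-allFin (λ r → sum (map (λ c → χ (T r c)) (allFin n))))
        (sum-cong-≗ (λ r → sum-allFin (λ c → χ (T r c))))

∣∣ᶜ-mono : ∀ {n} {S T : CellSet n} → S ⊆ᶜ T → ∣ S ∣ᶜ ≤ ∣ T ∣ᶜ
∣∣ᶜ-mono {S = S} {T} S⊆T rewrite ∣∣ᶜ-as-∑ S | ∣∣ᶜ-as-∑ T =
  ∑-mono-≤ (λ r → ∑-mono-≤ (λ c → χ-mono r c))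
  where
  χ-mono : ∀ r c → χ (S r c) ≤ χ (T r c)
  χ-mono r c with S r c in s
  ... | false = z≤n
  ... | true rewrite S⊆T r c s = ≤-refl

∣∣ᶜ-additive : ∀ {n} (A B C : CellSet n) → (∀ r c → χ (C r c) ≡ χ (A r c) + χ (B r c)) →
  ∣ C ∣ᶜ ≡ ∣ A ∣ᶜ + ∣ B ∣ᶜ
∣∣ᶜ-additive {n} A B C χ-+ = begin
  ∣ C ∣ᶜ                                                    ≡⟨ ∣∣ᶜ-as-∑ C ⟩
  ∑[ r < n ] ∑[ c < n ] χ (C r c)                           ≡⟨ sum-cong-≗ (λ r → sum-cong-≗ (χ-+ r)) ⟩
  ∑[ r < n ] ∑[ c < n ] (χ (A r c) + χ (B r c))             ≡⟨ sum-cong-≗ (λ r → ∑-distrib-+ (λ c → χ (A r c)) _) ⟩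
  ∑[ r < n ] (∑[ c < n ] χ (A r c) + ∑[ c < n ] χ (B r c))  ≡⟨ ∑-distrib-+ (λ r → ∑[ c < n ] χ (A r c)) _ ⟩
  ∑[ r < n ] ∑[ c < n ] χ (A r c) + ∑[ r < n ] ∑[ c < n ] χ (B r c)
                                                            ≡⟨ sym (cong₂ _+_ (∣∣ᶜ-as-∑ A) (∣∣ᶜ-as-∑ B)) ⟩
  ∣ A ∣ᶜ + ∣ B ∣ᶜ                                           ∎
  where open ≡-Reasoning

∣∣ᶜ-partition : ∀ {n m} (C : CellSet n) (A : Fin m → CellSet n) →
  (∀ r c → χ (C r c) ≡ ∑[ i < m ] χ (A i r c)) → ∣ C ∣ᶜ ≡ ∑[ i < m ] ∣ A i ∣ᶜ
∣∣ᶜ-partition {n} {m} C A χ-∑ = begin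
  ∣ C ∣ᶜ                                         ≡⟨ ∣∣ᶜ-as-∑ C ⟩
  ∑[ r < n ] ∑[ c < n ] χ (C r c)                ≡⟨ sum-cong-≗ (λ r → sum-cong-≗ (χ-∑ r)) ⟩
  ∑[ r < n ] ∑[ c < n ] ∑[ i < m ] χ (A i r c)   ≡⟨ sum-cong-≗ (λ r → ∑-comm (λ c i → χ (A i r c))) ⟩
  ∑[ r < n ] ∑[ i < m ] ∑[ c < n ] χ (A i r c)   ≡⟨ ∑-comm (λ r i → ∑[ c < n ] χ (A i r c)) ⟩
  ∑[ i < m ] ∑[ r < n ] ∑[ c < n ] χ (A i r c)   ≡⟨ sym (sum-cong-≗ (∣∣ᶜ-as-∑ ∘ A)) ⟩
  ∑[ i < m ] ∣ A i ∣ᶜ                            ∎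
  where open ≡-Reasoning

∣∣ᶜ-∪-disjoint : ∀ {n} {A B : CellSet n} → Disjointᶜ A B → ∣ A ∪ᶜ B ∣ᶜ ≡ ∣ A ∣ᶜ + ∣ B ∣ᶜ
∣∣ᶜ-∪-disjoint {A = A} {B} disjoint = ∣∣ᶜ-additive A B (A ∪ᶜ B) χ-∪
  where
  χ-∪ : ∀ r c → χ (A r c ∨ B r c) ≡ χ (A r c) + χ (B r c)
  χ-∪ r c with A r c in a | B r c in b
  ... | false | _     = refl
  ... | true  | false = refl
  ... | true  | true  = ⊥-elim (disjoint r c a b)

∣∣ᶜ-∩-∖ : ∀ {n} (A B : CellSet n) → ∣ A ∣ᶜ ≡ ∣ A ∩ᶜ B ∣ᶜ + ∣ A ∖ᶜ B ∣ᶜ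
∣∣ᶜ-∩-∖ A B = ∣∣ᶜ-additive (A ∩ᶜ B) (A ∖ᶜ B) A χ-split
  where
  χ-split : ∀ r c → χ (A r c) ≡ χ (A r c ∧ B r c) + χ (A r c ∧ not (B r c))
  χ-split r c with A r c | B r c
  ... | false | _     = refl
  ... | true  | true  = refl
  ... | true  | false = refl

IndependentFor-⊆ : ∀ {n} {P : Array n} {σ} {S S′ : CellSet n} →
  S ⊆ᶜ S′ → IndependentFor P σ S′ → IndependentFor P σ S
IndependentFor-⊆ S⊆S′ ((sameRow , sameCol) , supports) =
  ( (λ r c c′ s s′ → sameRow r c c′ (S⊆S′ r c s) (S⊆S′ r c′ s′))
  , (λ r r′ c s s′ → sameCol r r′ c (S⊆S′ r c s) (S⊆S′ r′ c s′)) )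
  , (λ r c s → supports r c (S⊆S′ r c s))

module _ {n : ℕ} (P : Array n) where

  Empty : CellSet n
  Empty r c = is-nothing (P r c)

  Holding : Fin n → CellSet n
  Holding σ r c = does (≡-dec Fin._≟_ (P r c) (just σ))

  Empty⇒nothing : ∀ {r c} → Empty r c ≡ true → P r c ≡ nothing
  Empty⇒nothing {r} {c} e with P r c
  ... | nothing = refl

  Holding⇒just : ∀ {σ r c} → Holding σ r c ≡ true → P r c ≡ just σ
  Holding⇒just {σ} {r} {c} = does-true⇒ (≡-dec Fin._≟_ (P r c) (just σ))

  just⇒Holding : ∀ {σ r c} → P r c ≡ just σ → Holding σ r c ≡ true
  just⇒Holding {σ} {r} {c} = dec-true (≡-dec Fin._≟_ (P r c) (just σ))

  EmptyCells-∩ᶜ-Empty : (T : CellSet n) → EmptyCells P (T ∩ᶜ Empty)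
  EmptyCells-∩ᶜ-Empty T r c e = Empty⇒nothing (∧-conicalʳ (T r c) _ e)

  ∣∖ᶜ-Empty∣-as-∑-Holding : (T : CellSet n) → ∣ T ∖ᶜ Empty ∣ᶜ ≡ ∑[ σ < n ] ∣ T ∩ᶜ Holding σ ∣ᶜ
  ∣∖ᶜ-Empty∣-as-∑-Holding T = ∣∣ᶜ-partition (T ∖ᶜ Empty) (λ σ → T ∩ᶜ Holding σ) χ-∑
    where
    χ-∑ : ∀ r c → χ ((T ∖ᶜ Empty) r c) ≡ ∑[ σ < n ] χ (T r c ∧ Holding σ r c)
    χ-∑ r c with T r c | P r c
    ... | false | _       = sym (sum-replicate-zero n)
    ... | true  | nothing = sym (sum-replicate-zero n)
    ... | true  | just s  = sym (∑-χ-≟ s)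

  supports-empty⇒missing : ∀ {r c σ} → P r c ≡ nothing → Supports P r c σ →
    MissingFromRow P r σ × MissingFromCol P c σ
  supports-empty⇒missing empty (inj₁ holds) with () ← trans (sym empty) holds
  supports-empty⇒missing empty (inj₂ (_ , missing)) = missing

  IndependentFor⇒filled⊆Holding : ∀ {σ} {S : CellSet n} → IndependentFor P σ S →
    S ∖ᶜ Empty ⊆ᶜ Holding σ
  IndependentFor⇒filled⊆Holding {S = S} (_ , supports) r c e
    with supports r c (∧-conicalˡ _ _ e)
  ... | inj₁ holds = just⇒Holding holds
  ... | inj₂ (empty , _) rewrite empty with () ← ∧-conicalʳ (S r c) false e

  module _ (latin : IsPartialLatinSquare P) where

    ∪ᶜ-Holding-independentFor : ∀ {σ} {U : CellSet n} → U ⊆ᶜ Empty → IndependentFor P σ U →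
      IndependentFor P σ (U ∪ᶜ Holding σ)
    ∪ᶜ-Holding-independentFor {σ} {U} U⊆Empty ((sameRow , sameCol) , supports) =
      (sameRow′ , sameCol′) , supports′
      where
      missing : ∀ {r c} → U r c ≡ true → MissingFromRow P r σ × MissingFromCol P c σ
      missing {r} {c} u = supports-empty⇒missing (Empty⇒nothing (U⊆Empty r c u)) (supports r c u)

      sameRow′ : ∀ r c c′ → (U ∪ᶜ Holding σ) r c ≡ true → (U ∪ᶜ Holding σ) r c′ ≡ true → c ≡ c′
      sameRow′ r c c′ v v′ with ∨-true {U r c} v | ∨-true {U r c′} v′
      ... | inj₁ u | inj₁ u′ = sameRow r c c′ u u′
      ... | inj₁ u | inj₂ h′ = ⊥-elim (proj₁ (missing u) c′ (Holding⇒just h′))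
      ... | inj₂ h | inj₁ u′ = ⊥-elim (proj₁ (missing u′) c (Holding⇒just h))
      ... | inj₂ h | inj₂ h′ = proj₁ latin r c c′ σ (Holding⇒just h) (Holding⇒just h′)

      sameCol′ : ∀ r r′ c → (U ∪ᶜ Holding σ) r c ≡ true → (U ∪ᶜ Holding σ) r′ c ≡ true → r ≡ r′
      sameCol′ r r′ c v v′ with ∨-true {U r c} v | ∨-true {U r′ c} v′
      ... | inj₁ u | inj₁ u′ = sameCol r r′ c u u′
      ... | inj₁ u | inj₂ h′ = ⊥-elim (proj₂ (missing u) r′ (Holding⇒just h′))
      ... | inj₂ h | inj₁ u′ = ⊥-elim (proj₂ (missing u′) r (Holding⇒just h))
      ... | inj₂ h | inj₂ h′ = proj₂ latin r r′ c σ (Holding⇒just h) (Holding⇒just h′)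

      supports′ : ∀ r c → (U ∪ᶜ Holding σ) r c ≡ true → Supports P r c σ
      supports′ r c v with ∨-true {U r c} v
      ... | inj₁ u = supports r c u
      ... | inj₂ h = inj₁ (Holding⇒just h)

    module _ {σ : Fin n} {T : CellSet n} {a : ℕ}
             (maximal : ∀ S → S ⊆ᶜ T → IndependentFor P σ S → ∣ S ∣ᶜ ≤ a) where

      ∣∣ᶜ+∣Holding∣≤α : ∀ {U} → U ⊆ᶜ T ∩ᶜ Empty → IndependentFor P σ U →
        ∣ U ∣ᶜ + ∣ T ∩ᶜ Holding σ ∣ᶜ ≤ a
      ∣∣ᶜ+∣Holding∣≤α {U} U⊆ independent =
        ≤-trans (≤-reflexive (sym (∣∣ᶜ-∪-disjoint disjoint))) (maximal V V⊆T V-independent)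
        where
        V : CellSet n
        V = U ∪ᶜ T ∩ᶜ Holding σ

        U⊆Empty : U ⊆ᶜ Empty
        U⊆Empty r c u = ∧-conicalʳ (T r c) _ (U⊆ r c u)

        disjoint : Disjointᶜ U (T ∩ᶜ Holding σ)
        disjoint r c u h with () ← trans (sym (Empty⇒nothing (U⊆Empty r c u)))
                                         (Holding⇒just (∧-conicalʳ (T r c) _ h))

        V⊆T : V ⊆ᶜ T
        V⊆T r c v with ∨-true {U r c} v
        ... | inj₁ u = ∧-conicalˡ _ _ (U⊆ r c u)
        ... | inj₂ h = ∧-conicalˡ _ _ h

        V⊆U∪Holding : V ⊆ᶜ U ∪ᶜ Holding σ
        V⊆U∪Holding r c v with ∨-true {U r c} v
        ... | inj₁ u rewrite u = refl
        ... | inj₂ h rewrite ∧-conicalʳ (T r c) _ h = ∨-zeroʳ (U r c)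

        V-independent : IndependentFor P σ V
        V-independent = IndependentFor-⊆ V⊆U∪Holding (∪ᶜ-Holding-independentFor U⊆Empty independent)

    IsAlpha-∩ᶜ-Empty : ∀ {σ T a} → IsAlpha P σ T a →
      Σ ℕ λ a′ → IsAlpha P σ (T ∩ᶜ Empty) a′ × a′ + ∣ T ∩ᶜ Holding σ ∣ᶜ ≤ a
    IsAlpha-∩ᶜ-Empty {σ} {T} {a} ((S , S⊆T , independent , refl) , maximal) =
      ∣ S′ ∣ᶜ , ((S′ , S′⊆ , S′-independent , refl) , maximal′) , ∣∣ᶜ+∣Holding∣≤α maximal S′⊆ S′-independent
      where
      S′ : CellSet n
      S′ = S ∩ᶜ Empty

      S′⊆ : S′ ⊆ᶜ T ∩ᶜ Empty
      S′⊆ r c s rewrite S⊆T r c (∧-conicalˡ _ _ s) = ∧-conicalʳ (S r c) _ s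

      S′-independent : IndependentFor P σ S′
      S′-independent = IndependentFor-⊆ (λ r c → ∧-conicalˡ _ _) independent

      filled⊆ : S ∖ᶜ Empty ⊆ᶜ T ∩ᶜ Holding σ
      filled⊆ r c s rewrite S⊆T r c (∧-conicalˡ _ _ s) = IndependentFor⇒filled⊆Holding independent r c s

      maximal′ : ∀ U → U ⊆ᶜ T ∩ᶜ Empty → IndependentFor P σ U → ∣ U ∣ᶜ ≤ ∣ S′ ∣ᶜ
      maximal′ U U⊆ U-independent = +-cancelʳ-≤ ∣ T ∩ᶜ Holding σ ∣ᶜ _ _ (begin
        ∣ U ∣ᶜ + ∣ T ∩ᶜ Holding σ ∣ᶜ   ≤⟨ ∣∣ᶜ+∣Holding∣≤α maximal U⊆ U-independent ⟩
        ∣ S ∣ᶜ                         ≡⟨ ∣∣ᶜ-∩-∖ S Empty ⟩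
        ∣ S′ ∣ᶜ + ∣ S ∖ᶜ Empty ∣ᶜ      ≤⟨ +-monoʳ-≤ ∣ S′ ∣ᶜ (∣∣ᶜ-mono filled⊆) ⟩
        ∣ S′ ∣ᶜ + ∣ T ∩ᶜ Holding σ ∣ᶜ  ∎)
        where open ≤-Reasoning

    HallInequality-∩ᶜ-Empty : (T : CellSet n) → HallInequality P (T ∩ᶜ Empty) → HallInequality P T
    HallInequality-∩ᶜ-Empty T hall α isα = begin
      ∣ T ∣ᶜ                                            ≡⟨ ∣∣ᶜ-∩-∖ T Empty ⟩
      ∣ T ∩ᶜ Empty ∣ᶜ + ∣ T ∖ᶜ Empty ∣ᶜ                 ≤⟨ +-mono-≤ (hall α′ (proj₁ ∘ proj₂ ∘ restricted))
                                                                     (≤-reflexive (∣∖ᶜ-Empty∣-as-∑-Holding T)) ⟩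
      sum (map α′ (allFin n)) + ∑[ σ < n ] holding σ    ≡⟨ cong (_+ ∑[ σ < n ] holding σ) (sum-allFin α′) ⟩
      ∑[ σ < n ] α′ σ + ∑[ σ < n ] holding σ            ≡⟨ sym (∑-distrib-+ α′ holding) ⟩
      ∑[ σ < n ] (α′ σ + holding σ)                     ≤⟨ ∑-mono-≤ (proj₂ ∘ proj₂ ∘ restricted) ⟩
      ∑[ σ < n ] α σ                                    ≡⟨ sym (sum-allFin α) ⟩
      sum (map α (allFin n))                            ∎
      where
      open ≤-Reasoning
      restricted : ∀ σ → Σ ℕ λ a′ → IsAlpha P σ (T ∩ᶜ Empty) a′ × a′ + ∣ T ∩ᶜ Holding σ ∣ᶜ ≤ α σ
      restricted σ = IsAlpha-∩ᶜ-Empty (isα σ)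
      α′ holding : Fin n → ℕ
      α′ = proj₁ ∘ restricted
      holding σ = ∣ T ∩ᶜ Holding σ ∣ᶜ

theorem5 : (n : ℕ) (P : Array n) → IsPartialLatinSquare P →
    (HallsCondition P → ((T : CellSet n) → EmptyCells P T → HallInequality P T))
    × (((T : CellSet n) → EmptyCells P T → HallInequality P T) → HallsCondition P)
theorem5 n P latin =
  (λ hall T _ → hall T) ,
  (λ hallOnEmpty T → HallInequality-∩ᶜ-Empty P latin T (hallOnEmpty (T ∩ᶜ Empty P) (EmptyCells-∩ᶜ-Empty P T)))
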